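{- Let $n \ge 2$, let $M \subseteq V(ST_3^n)$ and let $H_2$ be a copy of $ST_3^2$ in $ST_3^n$. Then $M$ is $H_2$-proper if and only if $M \cap V(H_2) \subseteq P_{H_2}$, where $P_{H_2}$ is the set of (three) proper vertices of $H_2$.
   Context: Sierpiński triangle graphs are defined recursively: $ST_3^0 = K_3$, whose three vertices are its extreme vertices, called top, left and right. For $n \ge 0$, $ST_3^{n+1}$ is obtained from three disjoint copies $T, L, R$ of $ST_3^n$ by identifying the left extreme vertex of $T$ with the top extreme vertex of $L$, the right extreme vertex of $T$ with the top extreme vertex of $R$, and the right extreme vertex of $L$ with the left extreme vertex of $R$; the extreme vertices of $ST_3^{n+1}$ are the top vertex of $T$, the left vertex of $L$ and the right vertex of $R$. $X(G)$ denotes the set of extreme vertices. For $0 \le m \le n$, the copies of $ST_3^m$ in $ST_3^n$ are: for $m=n$ the graph itself, and for $m<n$ the copies of $ST_3^m$ in each of the three copies $T,L,R$ of $ST_3^{n-1}$ used in the construction (recursively); each copy has its own extreme vertices. The interval $I(u,v)$ is the set of vertices lying on shortest $u,v$-paths. For a copy $H_2$ of $ST_3^2$ with extreme vertices $p_0,p_1,p_2$, its proper vertices are the vertices of $H_2$ not in $I(p_0,p_1) \cup I(p_0,p_2) \cup I(p_1,p_2)$; there are exactly three of them, and their set is denoted $P_{H_2}$. For $M \subseteq V(G)$, vertices $u,v$ are $M$-visible if some shortest $u,v$-path in $G$ contains no vertex of $M \setminus \{u,v\}$. A set $M \subseteq V(ST_3^n)$ is $H_2$-proper if for every $u \in V(H_2)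 \cap M$ and all $i,j \in \{0,1,2\}$, $u$ and $p_i$ are $M$-visible and $I(p_i,p_j) \cap M = \emptyset$ (all distances, intervals and visibility taken in $ST_3^n$). -}

module Defs where

open import Data.Nat using (ℕ; zero; suc; _+_; _^_; _≤_)
open import Data.Product using (_×_; _,_; Σ; ∃; ∃-syntax)
open import Data.Sum using (_⊎_)
open import Data.Fin using (Fin)
open import Data.List using (List; []; _∷_; length)
open import Data.List.Membership.Propositional using (_∈_)
open import Data.List.Relation.Unary.Unique.Propositional using (Unique)
open import Data.Vec using (Vec; []; _∷_)
open import Relation.Binary.PropositionalEquality using (_≡_)
open import Relation.Nullary using (¬_)

-- Vertices of ST_3^n are encoded as points of the triangular lattice,
-- in coordinates (a , b): a = steps towards the left corner,
-- b = steps towards the right corner.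
-- The recursive construction places the copies T, L, R of ST_3^n at
-- offsets (0,0), (2^n,0), (0,2^n); the three prescribed identifications
-- are then exactly the coincidences of coordinates (and there are no others).

Point : Set
Point = ℕ × ℕ

_⊕_ : Point → Point → Point
(a , b) ⊕ (c , d) = (a + c , b + d)

data Vertex : ℕ → Point → Set where
  top₀   : Vertex 0 (0 , 0)
  left₀  : Vertex 0 (1 , 0)
  right₀ : Vertex 0 (0 , 1)
  inT : ∀ {n p} → Vertex n p → Vertex (suc n) p
  inL : ∀ {n p} → Vertex n p → Vertex (suc n) (p ⊕ (2 ^ n , 0))
  inR : ∀ {n p} → Vertex n p → Vertex (suc n) (p ⊕ (0 , 2 ^ n))

data Edge : ℕ → Point → Point → Set where
  tl₀ : Edge 0 (0 , 0) (1 , 0)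
  lt₀ : Edge 0 (1 , 0) (0 , 0)
  tr₀ : Edge 0 (0 , 0) (0 , 1)
  rt₀ : Edge 0 (0 , 1) (0 , 0)
  lr₀ : Edge 0 (1 , 0) (0 , 1)
  rl₀ : Edge 0 (0 , 1) (1 , 0)
  eT : ∀ {n p q} → Edge n p q → Edge (suc n) p q
  eL : ∀ {n p q} → Edge n p q → Edge (suc n) (p ⊕ (2 ^ n , 0)) (q ⊕ (2 ^ n , 0))
  eR : ∀ {n p q} → Edge n p q → Edge (suc n) (p ⊕ (0 , 2 ^ n)) (q ⊕ (0 , 2 ^ n))

extreme : ℕ → Fin 3 → Point
extreme m Fin.zero = (0 , 0)
extreme m (Fin.suc Fin.zero) = (2 ^ m , 0)
extreme m (Fin.suc (Fin.suc Fin.zero)) = (0 , 2 ^ m)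

-- Copies of ST_3^m in ST_3^(k + m): given by an address w of length k
-- (which of T, L, R is chosen at each level, outermost first).

data Dir : Set where
  T L R : Dir

shift : Dir → ℕ → Point
shift T s = (0 , 0)
shift L s = (s , 0)
shift R s = (0 , s)

offset : (m : ℕ) → ∀ {k} → Vec Dir k → Point
offset m [] = (0 , 0)
offset m {suc k} (d ∷ w) = shift d (2 ^ (k + m)) ⊕ offset m w

InCopy : (m : ℕ) → ∀ {k} → Vec Dir k → Point → Set
InCopy m w x = ∃[ p ] (Vertex m p × x ≡ p ⊕ offset m w)

copyExtreme : (m : ℕ) → ∀ {k} → Vec Dir k → Fin 3 → Point
copyExtreme m w i = extreme m i ⊕ offset m w

data Walk (n : ℕ) : Point → Point → Set where
  stay : ∀ {u} → Vertex n u → Walk n u u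
  step : ∀ {u v w} → Edge n u v → Walk n v w → Walk n u w

len : ∀ {n u v} → Walk n u v → ℕ
len (stay _) = 0
len (step _ p) = suc (len p)

verts : ∀ {n u v} → Walk n u v → List Point
verts {u = u} (stay _) = u ∷ []
verts {u = u} (step _ p) = u ∷ verts p

record Path (n : ℕ) (u v : Point) : Set where
  constructor path
  field
    walk   : Walk n u v
    unique : Unique (verts walk)
open Path public

IsShortest : ∀ {n u v} → Path n u v → Set
IsShortest {n} {u} {v} p = (q : Path n u v) → len (walk p) ≤ len (walk q)

Interval : ℕ → Point → Point → Point → Set
Interval n u v x = ∃[ p ] (IsShortest {n} {u} {v} p × x ∈ verts (walk p))

Visible : ℕ → List Point → Point → Point → Set
Visible n M u v =
  ∃[ p ] (IsShortest {n} {u} {v} p ×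
          (∀ x → x ∈ verts (walk p) → x ∈ M → (x ≡ u ⊎ x ≡ v)))

module _ (n : ℕ) {k : ℕ} (w : Vec Dir k) where
  private
    p : Fin 3 → Point
    p = copyExtreme 2 w

    i0 i1 i2 : Fin 3
    i0 = Fin.zero
    i1 = Fin.suc Fin.zero
    i2 = Fin.suc (Fin.suc Fin.zero)

  ProperVertex : Point → Set
  ProperVertex x =
    InCopy 2 w x ×
    ¬ (Interval n (p i0) (p i1) x ⊎ Interval n (p i0) (p i2) x ⊎ Interval n (p i1) (p i2) x)

  H₂-proper : List Point → Set
  H₂-proper M =
    (∀ u → InCopy 2 w u → u ∈ M → ∀ i → Visible n M u (p i)) ×
    (∀ i j x → Interval n (p i) (p j) x → ¬ (x ∈ M))

{-# OPTIONS --safe #-}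
module Submission where

-- In the lattice coordinates of Defs, H₂ is ST_3^2 translated by its offset o.  Each of
-- the functionals a, b and a + b is additive and changes by at most one along an edge, so
-- it bounds distances from below, and a walk along which one of them changes by the
-- length of the walk is a geodesic.  Between two corners of H₂ the straight side is such
-- a walk for two of the functionals at once, and this pins every vertex of a geodesic
-- between the corners to that side.  Hence the intervals I(p_i, p_j) consist of boundary
-- vertices of H₂, so the proper vertices are the interior ones (1,1), (2,1), (1,2)
-- (shifted by o), and M ∩ V(H₂) ⊆ P_{H₂} keeps M off the intervals.  From each interior
-- vertex an explicit geodesic to each corner has all its other vertices on the boundary,
-- hence outside M, which gives visibility.  The converse direction is immediate.

open import Defs
open import Data.Empty using (⊥-elim)
open import Data.Fin using (Fin; zero; suc)
open import Data.List using (List; []; _∷_; _++_; map)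
import Data.List.Membership.DecPropositional as DecMembership
open import Data.List.Membership.Propositional using (_∈_; _∉_)
open import Data.List.Membership.Propositional.Properties
  using (∈-map⁺; ∈-map⁻; ∈-++⁺ˡ; ∈-++⁺ʳ; ∈-++⁻)
open import Data.List.Relation.Unary.All using (All; []; _∷_; lookup; all?)
open import Data.List.Relation.Unary.Any using (here; there)
import Data.List.Relation.Unary.AllPairs as AllPairs
open import Data.List.Relation.Unary.Unique.Propositional using (Unique)
import Data.List.Relation.Unary.Unique.DecPropositional as DecUnique
import Data.List.Relation.Unary.Unique.Propositional.Properties as Unique
open import Data.Nat using (ℕ; zero; suc; _+_; _^_; _≤_; _∸_; z≤n; s≤s; _≟_)
open import Data.Nat.Properties
open import Algebra.Properties.CommutativeSemigroup +-commutativeSemigroup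
  using (interchange; x∙yz≈y∙xz)
open import Data.Product using (_×_; _,_; proj₁; proj₂; ∃-syntax)
open import Data.Product.Properties using (≡-dec)
open import Data.Sum using (_⊎_; inj₁; inj₂)
open import Data.Vec using (Vec; []; _∷_)
open import Function.Bundles using (_⇔_; mk⇔)
open import Relation.Binary.Definitions using (DecidableEquality)
open import Relation.Binary.PropositionalEquality
open import Relation.Nullary.Decidable using (True; toWitness; from-yes; _⊎-dec_)

_≟ₚ_ : DecidableEquality Point
_≟ₚ_ = ≡-dec _≟_ _≟_

open DecMembership _≟ₚ_ using (_∈?_)
open DecUnique _≟ₚ_ using (unique?)

pattern top   = zero
pattern left  = suc zero
pattern right = suc (suc zero)

⊕-identityʳ : ∀ p → p ⊕ (0 , 0) ≡ p
⊕-identityʳ (a , b) = cong₂ _,_ (+-identityʳ a) (+-identityʳ b)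

⊕-assoc : ∀ p q r → (p ⊕ q) ⊕ r ≡ p ⊕ (q ⊕ r)
⊕-assoc (a , b) (c , d) (e , f) = cong₂ _,_ (+-assoc a c e) (+-assoc b d f)

⊕-comm : ∀ p q → p ⊕ q ≡ q ⊕ p
⊕-comm (a , b) (c , d) = cong₂ _,_ (+-comm a c) (+-comm b d)

⊕-cancelʳ : ∀ o {p q} → p ⊕ o ≡ q ⊕ o → p ≡ q
⊕-cancelʳ (c , d) {a , b} {a′ , b′} eq =
  cong₂ _,_ (+-cancelʳ-≡ c a a′ (cong proj₁ eq)) (+-cancelʳ-≡ d b b′ (cong proj₂ eq))

edge-sym : ∀ {n p q} → Edge n p q → Edge n q p
edge-sym tl₀ = lt₀
edge-sym lt₀ = tl₀
edge-sym tr₀ = rt₀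
edge-sym rt₀ = tr₀
edge-sym lr₀ = rl₀
edge-sym rl₀ = lr₀
edge-sym (eT e) = eT (edge-sym e)
edge-sym (eL e) = eL (edge-sym e)
edge-sym (eR e) = eR (edge-sym e)

edge-source : ∀ {n p q} → Edge n p q → Vertex n p
edge-source tl₀ = top₀
edge-source lt₀ = left₀
edge-source tr₀ = top₀
edge-source rt₀ = right₀
edge-source lr₀ = left₀
edge-source rl₀ = right₀
edge-source (eT e) = inT (edge-source e)
edge-source (eL e) = inL (edge-source e)
edge-source (eR e) = inR (edge-source e)

walk-vertex : ∀ {n u v x} (W : Walk n u v) → x ∈ verts W → Vertex n x
walk-vertex (stay v) (here refl) = v
walk-vertex (step e W) (here refl) = edge-source e
walk-vertex (step e W) (there x∈W) = walk-vertex W x∈W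

len-zero : ∀ {n u v} (W : Walk n u v) → len W ≡ 0 → u ≡ v
len-zero (stay _) _ = refl

record Between (n : ℕ) (u x v : Point) (ℓ : ℕ) : Set where
  field
    to-x    : Walk n u x
    from-x  : Walk n x v
    len-sum : len to-x + len from-x ≡ ℓ
open Between

len-sum⁻ : ∀ {n u x v ℓ} (B : Between n u x v ℓ) → len (from-x B) + len (to-x B) ≡ ℓ
len-sum⁻ B = trans (+-comm (len (from-x B)) _) (len-sum B)

split : ∀ {n u v x} (W : Walk n u v) → x ∈ verts W → Between n u x v (len W)
split (stay v) (here refl) = record { to-x = stay v ; from-x = stay v ; len-sum = refl }
split (step e W) (here refl) =
  record { to-x = stay (edge-source e) ; from-x = step e W ; len-sum = refl }
split (step e W) (there x∈W) =
  let B = split W x∈W in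
  record { to-x = step e (to-x B) ; from-x = from-x B ; len-sum = cong suc (len-sum B) }

module WalkMap {m n : ℕ} (ι : Point → Point)
               (ι-vertex : ∀ {p} → Vertex m p → Vertex n (ι p))
               (ι-edge : ∀ {p q} → Edge m p q → Edge n (ι p) (ι q)) where

  map-walk : ∀ {u v} → Walk m u v → Walk n (ι u) (ι v)
  map-walk (stay v) = stay (ι-vertex v)
  map-walk (step e W) = step (ι-edge e) (map-walk W)

  len-map-walk : ∀ {u v} (W : Walk m u v) → len (map-walk W) ≡ len W
  len-map-walk (stay _) = refl
  len-map-walk (step e W) = cong suc (len-map-walk W)

  verts-map-walk : ∀ {u v} (W : Walk m u v) → verts (map-walk W) ≡ map ι (verts W)
  verts-map-walk (stay _) = refl
  verts-map-walk (step e W) = cong (_ ∷_) (verts-map-walk W)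

  map-path : (∀ {p q} → ι p ≡ ι q → p ≡ q) → ∀ {u v} → Path m u v → Path n (ι u) (ι v)
  map-path ι-injective (path W W-unique) =
    path (map-walk W) (subst Unique (sym (verts-map-walk W)) (Unique.map⁺ ι-injective W-unique))

vertex-in : ∀ d {n p} → Vertex n p → Vertex (suc n) (p ⊕ shift d (2 ^ n))
vertex-in T v = subst (Vertex _) (sym (⊕-identityʳ _)) (inT v)
vertex-in L v = inL v
vertex-in R v = inR v

edge-in : ∀ d {n p q} → Edge n p q → Edge (suc n) (p ⊕ shift d (2 ^ n)) (q ⊕ shift d (2 ^ n))
edge-in T e = subst₂ (Edge _) (sym (⊕-identityʳ _)) (sym (⊕-identityʳ _)) (eT e)
edge-in L e = eL e
edge-in R e = eR e

⊕-offset-step : ∀ p o s → (p ⊕ o) ⊕ s ≡ p ⊕ (s ⊕ o)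
⊕-offset-step p o s = trans (⊕-assoc p o s) (cong (p ⊕_) (⊕-comm o s))

copy-vertex : ∀ {m k} (w : Vec Dir k) {p} → Vertex m p → Vertex (k + m) (p ⊕ offset m w)
copy-vertex [] v = subst (Vertex _) (sym (⊕-identityʳ _)) v
copy-vertex {m} (d ∷ w) {p} v =
  subst (Vertex _) (⊕-offset-step p (offset m w) _) (vertex-in d (copy-vertex w v))

copy-edge : ∀ {m k} (w : Vec Dir k) {p q} → Edge m p q →
            Edge (k + m) (p ⊕ offset m w) (q ⊕ offset m w)
copy-edge [] e = subst₂ (Edge _) (sym (⊕-identityʳ _)) (sym (⊕-identityʳ _)) e
copy-edge {m} (d ∷ w) {p} {q} e =
  subst₂ (Edge _) (⊕-offset-step p (offset m w) _) (⊕-offset-step q (offset m w) _)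
    (edge-in d (copy-edge w e))

-- Gauges

record Gauge : Set where
  field
    level       : Point → ℕ
    level-⊕     : ∀ p q → level (p ⊕ q) ≡ level p + level q
    level-edge₀ : ∀ {p q} → Edge 0 p q → level p ≤ suc (level q)
open Gauge

Climb : Gauge → ℕ → Point → Point → Set
Climb g ℓ u v = level g v ≡ ℓ + level g u

squeeze : ∀ {a b u x v} → x ≤ a + u → v ≤ b + x → v ≡ (a + b) + u → x ≡ a + u
squeeze {a} {b} {u} {x} {v} x≤ v≤ v≡ = ≤-antisym x≤ (+-cancelˡ-≤ b (a + u) x b+a+u≤b+x)
  where
  b+a+u≤b+x : b + (a + u) ≤ b + x
  b+a+u≤b+x = subst (_≤ b + x) (trans v≡ (trans (+-assoc a b u) (x∙yz≈y∙xz a b u))) v≤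

module _ (g : Gauge) where

  level-step-⊕ : ∀ {p q} s → level g p ≤ suc (level g q) →
                 level g (p ⊕ s) ≤ suc (level g (q ⊕ s))
  level-step-⊕ {p} {q} s le =
    subst₂ (λ a b → a ≤ suc b) (sym (level-⊕ g p s)) (sym (level-⊕ g q s))
           (+-monoˡ-≤ (level g s) le)

  level-edge : ∀ {n p q} → Edge n p q → level g p ≤ suc (level g q)
  level-edge {zero} e = level-edge₀ g e
  level-edge (eT e) = level-edge e
  level-edge (eL e) = level-step-⊕ _ (level-edge e)
  level-edge (eR e) = level-step-⊕ _ (level-edge e)

  level-walk : ∀ {n u v} (W : Walk n u v) → level g u ≤ len W + level g v
  level-walk (stay _) = ≤-refl
  level-walk (step e W) = ≤-trans (level-edge e) (s≤s (level-walk W))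

  level-walk⁻ : ∀ {n u v} (W : Walk n u v) → level g v ≤ len W + level g u
  level-walk⁻ (stay _) = ≤-refl
  level-walk⁻ {u = u} (step e W) =
    ≤-trans (level-walk⁻ W)
            (≤-trans (+-monoʳ-≤ (len W) (level-edge (edge-sym e)))
                     (≤-reflexive (+-suc (len W) (level g u))))

  rise⇒len-≥ : ∀ {n ℓ u v} → Climb g ℓ u v → (W : Walk n u v) → ℓ ≤ len W
  rise⇒len-≥ {ℓ = ℓ} {u} c W =
    +-cancelʳ-≤ (level g u) ℓ (len W) (subst (_≤ len W + level g u) c (level-walk⁻ W))

  fall⇒len-≥ : ∀ {n ℓ u v} → Climb g ℓ v u → (W : Walk n u v) → ℓ ≤ len W
  fall⇒len-≥ {ℓ = ℓ} {v = v} c W =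
    +-cancelʳ-≤ (level g v) ℓ (len W) (subst (_≤ len W + level g v) c (level-walk W))

  climb-⊕ : ∀ {ℓ p q} o → Climb g ℓ p q → Climb g ℓ (p ⊕ o) (q ⊕ o)
  climb-⊕ {ℓ} {p} {q} o c = begin
    level g (q ⊕ o)             ≡⟨ level-⊕ g q o ⟩
    level g q + level g o       ≡⟨ cong (_+ level g o) c ⟩
    ℓ + level g p + level g o   ≡⟨ +-assoc ℓ (level g p) (level g o) ⟩
    ℓ + (level g p + level g o) ≡⟨ cong (ℓ +_) (level-⊕ g p o) ⟨
    ℓ + level g (p ⊕ o)         ∎
    where open ≡-Reasoning

  rise-pinned : ∀ {n ℓ u x v} → Climb g ℓ u v → (B : Between n u x v ℓ) →
                Climb g (len (to-x B)) u x
  rise-pinned c B =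
    squeeze {a = len (to-x B)} (level-walk⁻ (to-x B)) (level-walk⁻ (from-x B))
            (trans c (cong (_+ _) (sym (len-sum B))))

  fall-pinned : ∀ {n ℓ u x v} → Climb g ℓ v u → (B : Between n u x v ℓ) →
                Climb g (len (from-x B)) v x
  fall-pinned c B =
    squeeze {a = len (from-x B)} (level-walk (from-x B)) (level-walk (to-x B))
            (trans c (cong (_+ _) (sym (len-sum⁻ B))))

leftward : Gauge
leftward = record
  { level = proj₁
  ; level-⊕ = λ _ _ → refl
  ; level-edge₀ = λ { tl₀ → z≤n ; lt₀ → s≤s z≤n ; tr₀ → z≤n
                    ; rt₀ → z≤n ; lr₀ → s≤s z≤n ; rl₀ → z≤n }
  }

rightward : Gauge
rightward = record
  { level = proj₂
  ; level-⊕ = λ _ _ → refl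
  ; level-edge₀ = λ { tl₀ → z≤n ; lt₀ → z≤n ; tr₀ → z≤n
                    ; rt₀ → s≤s z≤n ; lr₀ → z≤n ; rl₀ → s≤s z≤n }
  }

depth : Gauge
depth = record
  { level = λ (a , b) → a + b
  ; level-⊕ = λ (a , b) (c , d) → interchange a c b d
  ; level-edge₀ = λ { tl₀ → z≤n ; lt₀ → s≤s z≤n ; tr₀ → z≤n
                    ; rt₀ → s≤s z≤n ; lr₀ → s≤s z≤n ; rl₀ → s≤s z≤n }
  }

data LevelGap (ℓ : ℕ) (u v : Point) : Set where
  rise : (g : Gauge) → Climb g ℓ u v → LevelGap ℓ u v
  fall : (g : Gauge) → Climb g ℓ v u → LevelGap ℓ u v

gap⇒len-≥ : ∀ {n ℓ u v} → LevelGap ℓ u v → (W : Walk n u v) → ℓ ≤ len W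
gap⇒len-≥ (rise g c) = rise⇒len-≥ g c
gap⇒len-≥ (fall g c) = fall⇒len-≥ g c

gap-⊕ : ∀ {ℓ p q} o → LevelGap ℓ p q → LevelGap ℓ (p ⊕ o) (q ⊕ o)
gap-⊕ o (rise g c) = rise g (climb-⊕ g o c)
gap-⊕ o (fall g c) = fall g (climb-⊕ g o c)

record Distance (n : ℕ) (u v : Point) (ℓ : ℕ) : Set where
  field
    geodesic     : Path n u v
    geodesic-len : len (walk geodesic) ≡ ℓ
    len-≥        : (W : Walk n u v) → ℓ ≤ len W
open Distance

geodesic-shortest : ∀ {n u v ℓ} (D : Distance n u v ℓ) → IsShortest (geodesic D)
geodesic-shortest D Q = subst (_≤ len (walk Q)) (sym (geodesic-len D)) (len-≥ D (walk Q))

geodesic⊆interval : ∀ {n u v ℓ x} (D : Distance n u v ℓ) → x ∈ verts (walk (geodesic D)) →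
                    Interval n u v x
geodesic⊆interval D x∈ = geodesic D , geodesic-shortest D , x∈

interval-between : ∀ {n u v ℓ x} → Distance n u v ℓ → Interval n u v x → Between n u x v ℓ
interval-between {n} {u} {v} {ℓ} {x} D (P , P-shortest , x∈P) =
  record { to-x = to-x B ; from-x = from-x B ; len-sum = trans (len-sum B) len-P≡ℓ }
  where
  B : Between n u x v (len (walk P))
  B = split (walk P) x∈P
  len-P≡ℓ : len (walk P) ≡ ℓ
  len-P≡ℓ = ≤-antisym (subst (len (walk P) ≤_) (geodesic-len D) (P-shortest (geodesic D)))
                      (len-≥ D (walk P))

distance-self : ∀ {n u} → Vertex n u → Distance n u u 0
distance-self v = record
  { geodesic = path (stay v) ([] AllPairs.∷ AllPairs.[]) ; geodesic-len = refl ; len-≥ = λ _ → z≤n }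

interval-self : ∀ {n u x} → Vertex n u → Interval n u u x → x ≡ u
interval-self {n} {u} {x} v I = sym (len-zero (to-x B) (m+n≡0⇒m≡0 _ (len-sum B)))
  where
  B : Between n u x u 0
  B = interval-between (distance-self v) I

-- The graph ST_3^2

record GaugedPath (m : ℕ) (p q : Point) : Set where
  field
    route : Path m p q
    gap   : LevelGap (len (walk route)) p q
open GaugedPath

route-vertex : ∀ {m q r y} (G : GaugedPath m q r) → y ∈ verts (walk (route G)) → Vertex m y
route-vertex G = walk-vertex (walk (route G))

gauged : ∀ {p q} (W : Walk 2 p q) → LevelGap (len W) p q → {True (unique? (verts W))} →
         GaugedPath 2 p q
gauged W gap {W-unique} = record { route = path W (toWitness W-unique) ; gap = gap }

corner : Fin 3 → Point
corner = extreme 2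

corner-vertex : ∀ i → Vertex 2 (corner i)
corner-vertex top = inT (inT top₀)
corner-vertex left = inL (inL left₀)
corner-vertex right = inR (inR right₀)

top-left : GaugedPath 2 (corner top) (corner left)
top-left = gauged
  (step (eT (eT tl₀)) (step (eT (eL tl₀)) (step (eL (eT tl₀)) (step (eL (eL tl₀))
    (stay (corner-vertex left))))))
  (rise leftward refl)

left-top : GaugedPath 2 (corner left) (corner top)
left-top = gauged
  (step (eL (eL lt₀)) (step (eL (eT lt₀)) (step (eT (eL lt₀)) (step (eT (eT lt₀))
    (stay (corner-vertex top))))))
  (fall leftward refl)

top-right : GaugedPath 2 (corner top) (corner right)
top-right = gauged
  (step (eT (eT tr₀)) (step (eT (eR tr₀)) (step (eR (eT tr₀)) (step (eR (eR tr₀))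
    (stay (corner-vertex right))))))
  (rise rightward refl)

right-top : GaugedPath 2 (corner right) (corner top)
right-top = gauged
  (step (eR (eR rt₀)) (step (eR (eT rt₀)) (step (eT (eR rt₀)) (step (eT (eT rt₀))
    (stay (corner-vertex top))))))
  (fall rightward refl)

left-right : GaugedPath 2 (corner left) (corner right)
left-right = gauged
  (step (eL (eL lr₀)) (step (eL (eR lr₀)) (step (eR (eL lr₀)) (step (eR (eR lr₀))
    (stay (corner-vertex right))))))
  (rise rightward refl)

right-left : GaugedPath 2 (corner right) (corner left)
right-left = gauged
  (step (eR (eR rl₀)) (step (eR (eL rl₀)) (step (eL (eR rl₀)) (step (eL (eL rl₀))
    (stay (corner-vertex left))))))
  (rise leftward refl)

boundary : List Point
boundary =
  verts (walk (route top-left)) ++ verts (walk (route top-right)) ++ verts (walk (route left-right))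

interior : List Point
interior = (1 , 1) ∷ (2 , 1) ∷ (1 , 2) ∷ []

∈-boundary : ∀ {y} {y∈? : True (y ∈? boundary)} → y ∈ boundary
∈-boundary {y∈? = y∈?} = toWitness y∈?

boundary-points : ∀ {d e} → d + e ≡ 4 →
                  (d , 0) ∈ boundary × (0 , d) ∈ boundary × (d , e) ∈ boundary
boundary-points {0} refl = ∈-boundary , ∈-boundary , ∈-boundary
boundary-points {1} refl = ∈-boundary , ∈-boundary , ∈-boundary
boundary-points {2} refl = ∈-boundary , ∈-boundary , ∈-boundary
boundary-points {3} refl = ∈-boundary , ∈-boundary , ∈-boundary
boundary-points {4} refl = ∈-boundary , ∈-boundary , ∈-boundary
boundary-points {suc (suc (suc (suc (suc _))))} ()

vertices : ℕ → List Point
vertices zero = (0 , 0) ∷ (1 , 0) ∷ (0 , 1) ∷ []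
vertices (suc n) =
  vertices n ++ map (_⊕ (2 ^ n , 0)) (vertices n) ++ map (_⊕ (0 , 2 ^ n)) (vertices n)

∈-vertices : ∀ {n p} → Vertex n p → p ∈ vertices n
∈-vertices top₀ = here refl
∈-vertices left₀ = there (here refl)
∈-vertices right₀ = there (there (here refl))
∈-vertices (inT v) = ∈-++⁺ˡ (∈-vertices v)
∈-vertices {suc n} (inL v) = ∈-++⁺ʳ (vertices n) (∈-++⁺ˡ (∈-map⁺ _ (∈-vertices v)))
∈-vertices {suc n} (inR v) = ∈-++⁺ʳ (vertices n) (∈-++⁺ʳ _ (∈-map⁺ _ (∈-vertices v)))

boundary-or-interior : ∀ {y} → Vertex 2 y → y ∈ boundary ⊎ y ∈ interior
boundary-or-interior v = lookup every-vertex (∈-vertices v)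
  where
  every-vertex : All (λ y → y ∈ boundary ⊎ y ∈ interior) (vertices 2)
  every-vertex = from-yes (all? (λ y → (y ∈? boundary) ⊎-dec (y ∈? interior)) (vertices 2))

record Sightline (y c : Point) : Set where
  field
    gauged-path      : GaugedPath 2 y c
    rest-on-boundary : All (λ z → z ≡ y ⊎ z ∈ boundary) (verts (walk (route gauged-path)))
open Sightline

sightline : ∀ {y c} (G : GaugedPath 2 y c) →
            {True (all? (λ z → (z ≟ₚ y) ⊎-dec (z ∈? boundary)) (verts (walk (route G))))} →
            Sightline y c
sightline G {on-boundary} = record { gauged-path = G ; rest-on-boundary = toWitness on-boundary }

sightlines : All (λ y → ∀ i → Sightline y (corner i)) interior
sightlines = from₁₁ ∷ from₂₁ ∷ from₁₂ ∷ []
  where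
  from₁₁ : ∀ i → Sightline (1 , 1) (corner i)
  from₁₁ top = sightline (gauged
    (step (eT (eL rt₀)) (step (eT (eT lt₀)) (stay (corner-vertex top))))
    (fall depth refl))
  from₁₁ left = sightline (gauged
    (step (eT (eL rl₀)) (step (eL (eT tl₀)) (step (eL (eL tl₀)) (stay (corner-vertex left)))))
    (rise leftward refl))
  from₁₁ right = sightline (gauged
    (step (eT (eR lr₀)) (step (eR (eT tr₀)) (step (eR (eR tr₀)) (stay (corner-vertex right)))))
    (rise rightward refl))
  from₂₁ : ∀ i → Sightline (2 , 1) (corner i)
  from₂₁ top = sightline (gauged
    (step (eL (eT rt₀)) (step (eT (eL lt₀)) (step (eT (eT lt₀)) (stay (corner-vertex top)))))
    (fall depth refl))
  from₂₁ left = sightline (gauged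
    (step (eL (eT rl₀)) (step (eL (eL tl₀)) (stay (corner-vertex left))))
    (rise leftward refl))
  from₂₁ right = sightline (gauged
    (step (eL (eR tr₀)) (step (eR (eL lr₀)) (step (eR (eR lr₀)) (stay (corner-vertex right)))))
    (rise rightward refl))
  from₁₂ : ∀ i → Sightline (1 , 2) (corner i)
  from₁₂ top = sightline (gauged
    (step (eR (eT lt₀)) (step (eT (eR rt₀)) (step (eT (eT rt₀)) (stay (corner-vertex top)))))
    (fall depth refl))
  from₁₂ left = sightline (gauged
    (step (eR (eL tl₀)) (step (eL (eR rl₀)) (step (eL (eL rl₀)) (stay (corner-vertex left)))))
    (rise leftward refl))
  from₁₂ right = sightline (gauged
    (step (eR (eT lr₀)) (step (eR (eR tr₀)) (stay (corner-vertex right))))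
    (rise rightward refl))

-- A copy of ST_3^2 inside ST_3^(k+2)

module CopyOfST₂ {k : ℕ} (w : Vec Dir k) where

  N : ℕ
  N = suc (suc k)

  o : Point
  o = offset 2 w

  p : Fin 3 → Point
  p = copyExtreme 2 w

  embed-vertex : ∀ {q} → Vertex 2 q → Vertex N (q ⊕ o)
  embed-vertex {q} v = subst (λ n → Vertex n (q ⊕ o)) (+-comm k 2) (copy-vertex w v)

  embed-edge : ∀ {q r} → Edge 2 q r → Edge N (q ⊕ o) (r ⊕ o)
  embed-edge {q} {r} e = subst (λ n → Edge n (q ⊕ o) (r ⊕ o)) (+-comm k 2) (copy-edge w e)

  open WalkMap (_⊕ o) embed-vertex embed-edge

  distance : ∀ {q r} (G : GaugedPath 2 q r) → Distance N (q ⊕ o) (r ⊕ o) (len (walk (route G)))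
  distance G = record
    { geodesic = map-path (⊕-cancelʳ o) (route G)
    ; geodesic-len = len-map-walk (walk (route G))
    ; len-≥ = gap⇒len-≥ (gap-⊕ o (gap G))
    }

  on-geodesic : ∀ {q r y} (G : GaugedPath 2 q r) → y ∈ verts (walk (route G)) →
                Interval N (q ⊕ o) (r ⊕ o) (y ⊕ o)
  on-geodesic {y = y} G y∈ = geodesic⊆interval (distance G)
    (subst (y ⊕ o ∈_) (sym (verts-map-walk (walk (route G)))) (∈-map⁺ (_⊕ o) y∈))

  OnSide : Point → Set
  OnSide x =
    Interval N (p top) (p left) x ⊎ Interval N (p top) (p right) x ⊎ Interval N (p left) (p right) x

  boundary-on-side : ∀ {y} → y ∈ boundary → Vertex 2 y × OnSide (y ⊕ o)
  boundary-on-side y∈ with ∈-++⁻ (verts (walk (route top-left))) y∈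
  ... | inj₁ y∈side = route-vertex top-left y∈side , inj₁ (on-geodesic top-left y∈side)
  ... | inj₂ y∈rest with ∈-++⁻ (verts (walk (route top-right))) y∈rest
  ...   | inj₁ y∈side =
    route-vertex top-right y∈side , inj₂ (inj₁ (on-geodesic top-right y∈side))
  ...   | inj₂ y∈side =
    route-vertex left-right y∈side , inj₂ (inj₂ (on-geodesic left-right y∈side))

  OnBoundary : Point → Set
  OnBoundary x = ∃[ y ] (y ∈ boundary × x ≡ y ⊕ o)

  on-top-left : ∀ {d e x} → d + e ≡ 4 → Climb leftward d (p top) x → Climb depth d (p top) x →
                OnBoundary x
  on-top-left {d} {x = x₁ , x₂} d+e≡4 x₁≡ x₁+x₂≡ =
    (d , 0) , proj₁ (boundary-points d+e≡4) ,
    cong₂ _,_ x₁≡ (+-cancelˡ-≡ (d + proj₁ o) _ _ x₂≡)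
    where
    x₂≡ : d + proj₁ o + x₂ ≡ d + proj₁ o + proj₂ o
    x₂≡ = trans (cong (_+ x₂) (sym x₁≡)) (trans x₁+x₂≡ (sym (+-assoc d _ _)))

  on-top-right : ∀ {d e x} → d + e ≡ 4 → Climb rightward d (p top) x → Climb depth d (p top) x →
                 OnBoundary x
  on-top-right {d} {x = x₁ , x₂} d+e≡4 x₂≡ x₁+x₂≡ =
    (0 , d) , proj₁ (proj₂ (boundary-points d+e≡4)) ,
    cong₂ _,_ (+-cancelʳ-≡ (d + proj₂ o) _ _ x₁≡) x₂≡
    where
    x₁≡ : x₁ + (d + proj₂ o) ≡ proj₁ o + (d + proj₂ o)
    x₁≡ = trans (cong (x₁ +_) (sym x₂≡)) (trans x₁+x₂≡ (x∙yz≈y∙xz d (proj₁ o) (proj₂ o)))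

  on-left-right : ∀ {d e x} → d + e ≡ 4 →
                  Climb leftward d (p right) x → Climb rightward e (p left) x → OnBoundary x
  on-left-right {d} {e} d+e≡4 x₁≡ x₂≡ =
    (d , e) , proj₂ (proj₂ (boundary-points d+e≡4)) , cong₂ _,_ x₁≡ x₂≡

  -- Unlike the other climbs along sides this one is not refl: depth (p right) = oa + (4 + ob).
  top-right-depth : Climb depth 4 (p top) (p right)
  top-right-depth = climb-⊕ depth {p = corner top} {q = corner right} o refl

  interval-on-boundary : ∀ i j {x} → Interval N (p i) (p j) x → OnBoundary x
  interval-on-boundary top top I =
    corner top , ∈-boundary , interval-self (embed-vertex (corner-vertex top)) I
  interval-on-boundary left left I =
    corner left , ∈-boundary , interval-self (embed-vertex (corner-vertex left)) I
  interval-on-boundary right right I =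
    corner right , ∈-boundary , interval-self (embed-vertex (corner-vertex right)) I
  interval-on-boundary top left {x} I =
    on-top-left (len-sum B) (rise-pinned leftward refl B) (rise-pinned depth refl B)
    where
    B : Between N (p top) x (p left) 4
    B = interval-between (distance top-left) I
  interval-on-boundary left top {x} I =
    on-top-left (len-sum⁻ B) (fall-pinned leftward refl B) (fall-pinned depth refl B)
    where
    B : Between N (p left) x (p top) 4
    B = interval-between (distance left-top) I
  interval-on-boundary top right {x} I =
    on-top-right (len-sum B) (rise-pinned rightward refl B) (rise-pinned depth top-right-depth B)
    where
    B : Between N (p top) x (p right) 4
    B = interval-between (distance top-right) I
  interval-on-boundary right top {x} I =
    on-top-right (len-sum⁻ B) (fall-pinned rightward refl B) (fall-pinned depth top-right-depth B)
    where
    B : Between N (p right) x (p top) 4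
    B = interval-between (distance right-top) I
  interval-on-boundary left right {x} I =
    on-left-right (len-sum⁻ B) (fall-pinned leftward refl B) (rise-pinned rightward refl B)
    where
    B : Between N (p left) x (p right) 4
    B = interval-between (distance left-right) I
  interval-on-boundary right left {x} I =
    on-left-right (len-sum B) (rise-pinned leftward refl B) (fall-pinned rightward refl B)
    where
    B : Between N (p right) x (p left) 4
    B = interval-between (distance right-left) I

  module _ (M : List Point)
           (all-proper : ∀ x → InCopy 2 w x → x ∈ M → ProperVertex N w x) where

    boundary∉M : ∀ {y} → y ∈ boundary → y ⊕ o ∉ M
    boundary∉M y∈ y⊕o∈M =
      proj₂ (all-proper _ (_ , proj₁ (boundary-on-side y∈) , refl) y⊕o∈M)
            (proj₂ (boundary-on-side y∈))

    sightline-visible : ∀ {y c} → Sightline y c → Visible N M (y ⊕ o) (c ⊕ o)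
    sightline-visible {y} {c} S = geodesic D , geodesic-shortest D , only-start-in-M
      where
      D : Distance N (y ⊕ o) (c ⊕ o) (len (walk (route (gauged-path S))))
      D = distance (gauged-path S)
      only-start-in-M : ∀ x → x ∈ verts (walk (geodesic D)) → x ∈ M →
                        x ≡ y ⊕ o ⊎ x ≡ c ⊕ o
      only-start-in-M x x∈ x∈M with ∈-map⁻ (_⊕ o) (subst (x ∈_) (verts-map-walk _) x∈)
      ... | z , z∈ , refl with lookup (rest-on-boundary S) z∈
      ...   | inj₁ refl = inj₁ refl
      ...   | inj₂ z∈boundary = ⊥-elim (boundary∉M z∈boundary x∈M)

    H₂-proper-if-all-proper : H₂-proper N w M
    H₂-proper-if-all-proper = copy-visible , interval-avoids-M
      where
      copy-visible : ∀ u → InCopy 2 w u → u ∈ M → ∀ i → Visible N M u (p i)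
      copy-visible _ (y , v , refl) u∈M i with boundary-or-interior v
      ... | inj₁ y∈boundary = ⊥-elim (boundary∉M y∈boundary u∈M)
      ... | inj₂ y∈interior = sightline-visible (lookup sightlines y∈interior i)

      interval-avoids-M : ∀ i j x → Interval N (p i) (p j) x → x ∉ M
      interval-avoids-M i j x I with interval-on-boundary i j I
      ... | y , y∈ , refl = boundary∉M y∈

all-proper-if-H₂-proper : ∀ {n k} (w : Vec Dir k) {M} → H₂-proper n w M →
                          ∀ x → InCopy 2 w x → x ∈ M → ProperVertex n w x
all-proper-if-H₂-proper w (_ , avoids) x x∈H₂ x∈M = x∈H₂ , λ where
  (inj₁ I) → avoids top left x I x∈M
  (inj₂ (inj₁ I)) → avoids top right x I x∈M
  (inj₂ (inj₂ I)) → avoids left right x I x∈M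

proposition5 : (n : ℕ) → 2 ≤ n → (M : List Point) → All (Vertex n) M →
               (w : Vec Dir (n ∸ 2)) →
               H₂-proper n w M ⇔ (∀ x → InCopy 2 w x → x ∈ M → ProperVertex n w x)
proposition5 0 ()
proposition5 1 (s≤s ())
proposition5 (suc (suc k)) _ M _ w =
  mk⇔ (all-proper-if-H₂-proper w) (CopyOfST₂.H₂-proper-if-all-proper w M)
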